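{- For every $\mathrm{GP}^2$ sentence $\varphi$ in normal form, $\varphi$ is finitely satisfiable if and only if it has a finite pseudo-model.
   Context: Vocabulary: unary $U_1,\dots,U_n$, binary $R_1,\dots,R_m$. 1-types: maximal consistent subsets of $\{U_i(x),\neg U_i(x)\}_{i\le n}\cup\{R_i(x,x),\neg R_i(x,x)\}_{i\le m}$ ($\mathsf{OneTps}$). 2-types: maximal consistent subsets of $\{R_i(x,y),\neg R_i(x,y),R_i(y,x),\neg R_i(y,x)\}_{i\le m}$ ($\mathsf{TwoTps}$); the silent 2-type has only negated literals, the rest are audible ($\mathsf{TwoTps}^+$); $\bar\eta$ (dual) swaps $x,y$; $\mathsf{TwoTps}_t$ = 2-types containing $R_t(x,y)$. Normal form: $\varphi=\forall x\,\gamma(x)\wedge\bigwedge_{i\le m}\forall x\forall y\,(R_i(x,y)\wedge x\neq y)\to\alpha_i(x,y)\wedge\bigwedge_{i\le n}\forall x\,U_i(x)\to P_i(x)$ with $\gamma,\alpha_i$ quantifier-free and $P_i(x)=\big(\sum_{t\le m}\lambda_{i,t}\#_y[R_t(x,y)\wedge x\neq y]\big)\circledast_i\delta_i$ (integers $\lambda_{i,t},\delta_i$, (in)equality $\circledast_i$). A 1-type $\pi$ is compatible with $\varphi$ if $\pi(x)\models\gamma(x)$; $\langle\pi_1,\eta,\pi_2\rangle$ is compatible if $\pi_1(x)\wedge\eta(x,y)\wedge\pi_2(y)$ and $\pi_2(x)\wedge\bar\eta(x,y)\wedge\pi_1(y)$ both entail $\bigwedge_i(R_i(x,y)\wedge x\neq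 y)\to\alpha_i(x,y)$. The characteristic system $\mathcal{C}^\varphi_\pi$ of a 1-type $\pi$: variables $x_{\eta,\pi'}$ ($\eta\in\mathsf{TwoTps}^+$, $\pi'\in\mathsf{OneTps}$); constraints $x_{\eta,\pi'}=0$ when $\pi'$ or $\langle\pi,\eta,\pi'\rangle$ is incompatible with $\varphi$; and for each $i$ with $U_i(x)\in\pi$: $\big(\sum_t\lambda_{i,t}\sum_{\eta\in\mathsf{TwoTps}_t}\sum_{\pi'}x_{\eta,\pi'}\big)\circledast_i\delta_i$. A colored multigraph (in the vocabulary of types) is a finite nonempty vertex set $V$ with a labelling $\mathrm{OneTp}:V\to\mathsf{OneTps}$ and a finite multiset of edges between distinct vertices (possibly several between the same pair), each edge between $v$ and $u$ carrying a 2-type $\eta$ as seen from $v$ (and $\bar\eta$ as seen from $u$). For a vertex $v$, the behavior vector $\mathrm{bh}(v)\in\mathbb{N}^{\mathsf{TwoTps}^+\times\mathsf{OneTps}}$ has entry at $(\eta,\pi)$ equal to the number of edges incident to $v$ whose 2-type seen from $v$ is $\eta$ and whose other endpoint has 1-type $\pi$. A finite pseudo-model of $\varphi$ is such a colored multigraph in which: every vertex's 1-type is compatible with $\varphi$; for every edge from $v_1$ to $v_2$ with 2-type $\eta$, $\langle\mathrm{OneTp}(v_1),\eta,\mathrm{OneTp}(v_2)\rangle$ is compatible with $\varphi$; and for every vertex $v$, $\mathrm{bh}(v)$ is a natural-number solution of $\mathcal{C}^\varphi_{\mathrm{OneTp}(v)}$. $\varphi$ is finitely satisfiable if it has a finite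 model. -}

module Defs where

open import Data.Bool using (Bool; true; false; _∧_; _∨_; not; if_then_else_)
import Data.Bool.Properties as BoolP
open import Data.Nat using (ℕ; zero; suc)
import Data.Nat as ℕ
open import Data.Fin using (Fin; zero; suc)
import Data.Fin as Fin
open import Data.Integer using (ℤ; +_; _<_; _≤_; _>_; _≥_)
import Data.Integer as ℤ
open import Data.Nat.ListAction using (sum)
open import Data.List using (List; []; _∷_; map; allFin; cartesianProduct; _++_)
open import Data.Vec using (Vec; []; _∷_; lookup)
import Data.Vec.Properties as VecP
open import Data.Product using (_×_; _,_; proj₁; proj₂; Σ; ∃)
import Data.Product.Properties as ProdP
open import Relation.Binary.PropositionalEquality using (_≡_; _≢_)
open import Relation.Binary.Definitions using (DecidableEquality)
open import Relation.Nullary using (Dec; yes; no; ¬_)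
open import Relation.Nullary.Decidable using (⌊_⌋)
open import Data.List.Membership.Propositional using (_∈_)

-- Vocabulary: n unary symbols U_0..U_{n-1}, m binary symbols R_0..R_{m-1}.
-- Variables of a formula with V free variables: Fin V
-- (Fin 1 = {x}, Fin 2 = {x , y} with x = zero, y = suc zero).

data QF (n m V : ℕ) : Set where
  ⊤' ⊥'  : QF n m V
  U      : Fin n → Fin V → QF n m V
  R      : Fin m → Fin V → Fin V → QF n m V
  _≐_    : Fin V → Fin V → QF n m V
  ¬'_    : QF n m V → QF n m V
  _∧'_ _∨'_ _⇒'_ : QF n m V → QF n m V → QF n m V

infix 8 _≐_
infix 7 ¬'_
infixr 6 _∧'_
infixr 5 _∨'_
infixr 4 _⇒'_

record AtomEnv (n m V : ℕ) : Set where
  field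
    unary  : Fin n → Fin V → Bool
    binary : Fin m → Fin V → Fin V → Bool
    equal  : Fin V → Fin V → Bool

⟦_⟧ : ∀ {n m V} → QF n m V → AtomEnv n m V → Bool
⟦ ⊤' ⟧ e = true
⟦ ⊥' ⟧ e = false
⟦ U i v ⟧ e = AtomEnv.unary e i v
⟦ R i v w ⟧ e = AtomEnv.binary e i v w
⟦ v ≐ w ⟧ e = AtomEnv.equal e v w
⟦ ¬' φ ⟧ e = not (⟦ φ ⟧ e)
⟦ φ ∧' ψ ⟧ e = ⟦ φ ⟧ e ∧ ⟦ ψ ⟧ e
⟦ φ ∨' ψ ⟧ e = ⟦ φ ⟧ e ∨ ⟦ ψ ⟧ e
⟦ φ ⇒' ψ ⟧ e = not (⟦ φ ⟧ e) ∨ ⟦ ψ ⟧ e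

data Cmp : Set where
  `= `≠ `< `≤ `> `≥ : Cmp

⟦_⟧ᶜ : Cmp → ℤ → ℤ → Set
⟦ `= ⟧ᶜ a b = a ≡ b
⟦ `≠ ⟧ᶜ a b = a ≢ b
⟦ `< ⟧ᶜ a b = a < b
⟦ `≤ ⟧ᶜ a b = a ≤ b
⟦ `> ⟧ᶜ a b = a > b
⟦ `≥ ⟧ᶜ a b = a ≥ b

sumℤ : List ℤ → ℤ
sumℤ [] = + 0
sumℤ (z ∷ zs) = z ℤ.+ sumℤ zs

-- A GP² sentence in normal form:
--   ∀x γ(x) ∧ ⋀_i ∀x∀y (R_i(x,y) ∧ x≠y → α_i(x,y))
--           ∧ ⋀_i ∀x (U_i(x) → (Σ_t λ_{i,t} #_y[R_t(x,y) ∧ x≠y]) ⊛_i δ_i)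
record NormalForm (n m : ℕ) : Set where
  field
    γ   : QF n m 1
    α   : Fin m → QF n m 2
    λ'  : Fin n → Fin m → ℤ
    δ   : Fin n → ℤ
    cmp : Fin n → Cmp

record FinStructure (n m : ℕ) : Set where
  field
    size   : ℕ                       -- domain is Fin (suc size): finite, nonempty
    Uᴵ     : Fin n → Fin (suc size) → Bool
    Rᴵ     : Fin m → Fin (suc size) → Fin (suc size) → Bool

module _ {n m : ℕ} (𝔄 : FinStructure n m) where
  open FinStructure 𝔄

  Dom : Set
  Dom = Fin (suc size)

  envᴬ : ∀ {V} → (Fin V → Dom) → AtomEnv n m V
  envᴬ ρ = record
    { unary  = λ i v → Uᴵ i (ρ v)
    ; binary = λ i v w → Rᴵ i (ρ v) (ρ w)
    ; equal  = λ v w → ⌊ ρ v Fin.≟ ρ w ⌋ }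

  assign1 : Dom → Fin 1 → Dom
  assign1 a _ = a

  assign2 : Dom → Dom → Fin 2 → Dom
  assign2 a b zero = a
  assign2 a b (suc _) = b

  outCount : Fin m → Dom → ℕ
  outCount t a = sum (map (λ b → if Rᴵ t a b ∧ not ⌊ a Fin.≟ b ⌋ then 1 else 0) (allFin (suc size)))

  _⊨_ : NormalForm n m → Set
  _⊨_ φ =
      (∀ (a : Dom) → ⟦ γ ⟧ (envᴬ (assign1 a)) ≡ true)
    × (∀ (i : Fin m) (a b : Dom) → Rᴵ i a b ≡ true → a ≢ b → ⟦ α i ⟧ (envᴬ (assign2 a b)) ≡ true)
    × (∀ (i : Fin n) (a : Dom) → Uᴵ i a ≡ true →
         ⟦ cmp i ⟧ᶜ (sumℤ (map (λ t → λ' i t ℤ.* + outCount t a) (allFin m))) (δ i))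
    where open NormalForm φ

FinitelySatisfiable : ∀ {n m} → NormalForm n m → Set
FinitelySatisfiable {n} {m} φ = Σ (FinStructure n m) (λ 𝔄 → 𝔄 ⊨ φ)

-- A 1-type: truth values of U_i(x) (i<n) and R_i(x,x) (i<m).
-- (Maximal consistent sets of these literals ↔ such truth assignments.)
OneTp : ℕ → ℕ → Set
OneTp n m = Vec Bool n × Vec Bool m

-- A 2-type: truth values of R_i(x,y) (first component) and R_i(y,x) (second).
TwoTp : ℕ → Set
TwoTp m = Vec Bool m × Vec Bool m

dual : ∀ {m} → TwoTp m → TwoTp m
dual (f , b) = (b , f)

Silent : ∀ {m} → TwoTp m → Set
Silent {m} (f , b) = ∀ (i : Fin m) → lookup f i ≡ false × lookup b i ≡ false

Audible : ∀ {m} → TwoTp m → Set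
Audible η = ¬ Silent η

-- η ∈ TwoTps_t  iff  R_t(x,y) ∈ η
InTwoTps : ∀ {m} → Fin m → TwoTp m → Bool
InTwoTps t (f , b) = lookup f t

allVecs : (k : ℕ) → List (Vec Bool k)
allVecs zero = [] ∷ []
allVecs (suc k) = map (true ∷_) (allVecs k) ++ map (false ∷_) (allVecs k)

allOneTps : (n m : ℕ) → List (OneTp n m)
allOneTps n m = cartesianProduct (allVecs n) (allVecs m)

allTwoTps : (m : ℕ) → List (TwoTp m)
allTwoTps m = cartesianProduct (allVecs m) (allVecs m)

_≟₁_ : ∀ {n m} → DecidableEquality (OneTp n m)
_≟₁_ = ProdP.≡-dec (VecP.≡-dec BoolP._≟_) (VecP.≡-dec BoolP._≟_)

_≟₂_ : ∀ {m} → DecidableEquality (TwoTp m)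
_≟₂_ = ProdP.≡-dec (VecP.≡-dec BoolP._≟_) (VecP.≡-dec BoolP._≟_)

env₁ : ∀ {n m} → OneTp n m → AtomEnv n m 1
env₁ (u , r) = record
  { unary = λ i _ → lookup u i ; binary = λ i _ _ → lookup r i ; equal = λ _ _ → true }

env₂ : ∀ {n m} → OneTp n m → TwoTp m → OneTp n m → AtomEnv n m 2
env₂ (u₁ , r₁) (f , b) (u₂ , r₂) = record { unary = un ; binary = bin ; equal = eq }
  where
  un : _ → Fin 2 → Bool
  un i zero = lookup u₁ i
  un i (suc _) = lookup u₂ i
  bin : _ → Fin 2 → Fin 2 → Bool
  bin i zero zero = lookup r₁ i
  bin i zero (suc _) = lookup f i
  bin i (suc _) zero = lookup b i
  bin i (suc _) (suc _) = lookup r₂ i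
  eq : Fin 2 → Fin 2 → Bool
  eq zero zero = true
  eq zero (suc _) = false
  eq (suc _) zero = false
  eq (suc _) (suc _) = true

module _ {n m : ℕ} (φ : NormalForm n m) where
  open NormalForm φ

  Compatible₁ : OneTp n m → Set
  Compatible₁ π = ⟦ γ ⟧ (env₁ π) ≡ true

  -- π₁(x) ∧ η(x,y) ∧ π₂(y) ⊨ ⋀_i (R_i(x,y) ∧ x ≠ y → α_i(x,y))
  -- (when x = y the premise x ≠ y fails, so only the case x ≠ y matters)
  Entails₂ : OneTp n m → TwoTp m → OneTp n m → Set
  Entails₂ π₁ η π₂ = ∀ (i : Fin m) → ⟦ (R i zero (suc zero) ∧' ¬' (zero ≐ suc zero)) ⇒' α i ⟧ (env₂ π₁ η π₂) ≡ true

  Compatible₂ : OneTp n m → TwoTp m → OneTp n m → Set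
  Compatible₂ π₁ η π₂ = Entails₂ π₁ η π₂ × Entails₂ π₂ (dual η) π₁

  -- Candidate solutions: vectors indexed by TwoTps × OneTps; only the entries with audible η
  -- (the variables of the characteristic system) are constrained/used.
  Assignment : Set
  Assignment = TwoTp m → OneTp n m → ℕ

  IsSolution : OneTp n m → Assignment → Set
  IsSolution π x =
      (∀ (η : TwoTp m) (π' : OneTp n m) → Audible η → ¬ Compatible₁ π' → x η π' ≡ 0)
    × (∀ (η : TwoTp m) (π' : OneTp n m) → Audible η → ¬ Compatible₂ π η π' → x η π' ≡ 0)
    × (∀ (i : Fin n) → lookup (proj₁ π) i ≡ true →
         ⟦ cmp i ⟧ᶜ
           (sumℤ (map (λ t → λ' i t ℤ.*
              + sum (map (λ η → if InTwoTps t η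
                                 then sum (map (λ π' → x η π') (allOneTps n m))
                                 else 0)
                         (allTwoTps m)))
             (allFin m)))
           (δ i))

record Edge (k : ℕ) (m : ℕ) : Set where
  field
    src tgt : Fin k
    distinct : src ≢ tgt
    tp : TwoTp m          -- the 2-type as seen from src (dual seen from tgt)

record ColoredMultigraph (n m : ℕ) : Set where
  field
    size  : ℕ                           -- vertex set Fin (suc size): finite, nonempty
    oneTp : Fin (suc size) → OneTp n m
    edges : List (Edge (suc size) m)    -- a finite multiset of edges

module _ {n m : ℕ} (G : ColoredMultigraph n m) where
  open ColoredMultigraph G

  private
    ind : Bool → ℕ
    ind true = 1
    ind false = 0

  bh : Fin (suc size) → TwoTp m → OneTp n m → ℕ
  bh v η π = sum (map contrib edges)
    where
    contrib : Edge (suc size) m → ℕ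
    contrib e = ind (⌊ Edge.src e Fin.≟ v ⌋ ∧ ⌊ Edge.tp e ≟₂ η ⌋ ∧ ⌊ oneTp (Edge.tgt e) ≟₁ π ⌋)
            ℕ.+ ind (⌊ Edge.tgt e Fin.≟ v ⌋ ∧ ⌊ dual (Edge.tp e) ≟₂ η ⌋ ∧ ⌊ oneTp (Edge.src e) ≟₁ π ⌋)

IsPseudoModel : ∀ {n m} → NormalForm n m → ColoredMultigraph n m → Set
IsPseudoModel {n} {m} φ G =
    (∀ v → Compatible₁ φ (oneTp v))
  × (∀ (e : Edge (suc size) m) → e ∈ edges →
       Compatible₂ φ (oneTp (Edge.src e)) (Edge.tp e) (oneTp (Edge.tgt e)))
  × (∀ v → IsSolution φ (oneTp v) (bh G v))
  where open ColoredMultigraph G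

HasFinitePseudoModel : ∀ {n m} → NormalForm n m → Set
HasFinitePseudoModel {n} {m} φ = Σ (ColoredMultigraph n m) (IsPseudoModel φ)

{-# OPTIONS --safe #-}
module Submission where

-- A model yields a pseudo-model whose vertices are its elements, with one edge for each pair
-- a < b carrying the 2-type of (a, b); the behaviour vector of a vertex then counts exactly
-- its R_t-successors.  Conversely, number the edges of a pseudo-model 0, …, L-1 and take the
-- 2^L-fold cover with elements V × {0,1}^L, in which edge j from u to w joins (u, c) to
-- (w, c with bit j toggled).  Different edges toggle different bits, so two elements are
-- joined by at most one edge, whose 2-type becomes theirs (silent if there is none), and an
-- element has exactly one neighbour for each edge at its vertex.  Hence the out-degrees in the
-- cover are the behaviour counts of the characteristic system, and all constraints transfer.

open import Algebra.Properties.CommutativeSemigroup using (interchange)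
open import Data.Bool using (Bool; true; false; _∧_; _∨_; not; if_then_else_)
import Data.Bool.Properties as Bool
open import Data.Bool.Properties using (∧-identityʳ; ∧-zeroʳ; not-involutive; not-¬)
import Data.Integer as ℤ
open import Data.Nat using (ℕ; zero; suc; _+_)
open import Data.Nat.Properties using (+-identityʳ; +-commutativeSemigroup)
open import Data.Nat.ListAction using (sum)
open import Data.Nat.ListAction.Properties using (sum-++)
open import Data.Fin using (Fin; zero; suc)
import Data.Fin as Fin
open import Data.Fin.Properties using (<-cmp; <⇒≢)
open import Data.List using (List; []; _∷_; map; allFin; concatMap; cartesianProduct; _++_; length; lookup)
open import Data.List.Properties using (map-++; map-cong; map-∘; map-tabulate; tabulate-lookup)
open import Data.List.Membership.Propositional using (_∈_)
open import Data.List.Membership.Propositional.Properties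
  using (∈-lookup; ∈-concatMap⁻; ∈-allFin; ∈-map⁺; ∈-map⁻; ∈-++⁺ˡ; ∈-++⁺ʳ; ∈-cartesianProduct⁺)
open import Data.List.Relation.Binary.Disjoint.Propositional using (Disjoint)
open import Data.List.Relation.Unary.All using (All; [])
import Data.List.Relation.Unary.All as All
open import Data.List.Relation.Unary.Any using (here; there; satisfied)
open import Data.List.Relation.Unary.Unique.Propositional using (Unique; []; _∷_)
import Data.List.Relation.Unary.Unique.Propositional.Properties as Unique
open import Data.Vec using (Vec; []; _∷_; _[_]%=_)
import Data.Vec as Vec
import Data.Vec.Properties as Vec
open import Data.Vec.Properties
  using (updateAt-updateAt-local; updateAt-id; lookup∘updateAt; lookup∘updateAt′; lookup-replicate;
         ∷-injectiveʳ; lookup∘tabulate; tabulate∘lookup; tabulate-cong)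
open import Data.Product using (_×_; _,_; proj₁; proj₂; swap)
open import Data.Sum using (_⊎_; inj₁; inj₂)
open import Function using (_∘_; _⇔_; mk⇔; Equivalence)
open import Relation.Binary.Definitions using (DecidableEquality; tri<; tri≈; tri>)
open import Relation.Binary.PropositionalEquality
open import Relation.Binary.PropositionalEquality using () renaming (trans to infixr 5 _∙_)
open import Relation.Nullary using (¬_; Dec; yes; no; contradiction; _×-dec_)
open import Relation.Nullary.Decidable using (⌊_⌋; isYes≗does; dec-true; dec-false; does-⇔)

open import Defs

⌊⌋-true : ∀ {P : Set} (p? : Dec P) → P → ⌊ p? ⌋ ≡ true
⌊⌋-true p? p = trans (isYes≗does p?) (dec-true p? p)

⌊⌋-false : ∀ {P : Set} (p? : Dec P) → ¬ P → ⌊ p? ⌋ ≡ false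
⌊⌋-false p? ¬p = trans (isYes≗does p?) (dec-false p? ¬p)

⌊⌋-refl : ∀ {k} (a : Fin k) → ⌊ a Fin.≟ a ⌋ ≡ true
⌊⌋-refl a = ⌊⌋-true (a Fin.≟ a) refl

⌊⌋-⇔ : ∀ {P Q : Set} (p? : Dec P) (q? : Dec Q) → P ⇔ Q → ⌊ p? ⌋ ≡ ⌊ q? ⌋
⌊⌋-⇔ p? q? p⇔q = trans (isYes≗does p?) (trans (does-⇔ p⇔q p? q?) (sym (isYes≗does q?)))

-- Written with if_then_else_ so that the summands of outCount are literally of the form 𝟙 b.
𝟙 : Bool → ℕ
𝟙 b = if b then 1 else 0

implication-true : ∀ r x → (not r ∨ x ≡ true) ⇔ (r ≡ true → x ≡ true)
implication-true true  x = mk⇔ (λ x≡true _ → x≡true) (λ r⇒x → r⇒x refl)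
implication-true false x = mk⇔ (λ _ ()) (λ _ → refl)

𝟙-⌊⌋³-false : ∀ {P Q S : Set} (p? : Dec P) (q? : Dec Q) (s? : Dec S) →
               ¬ (P × Q × S) → 𝟙 (⌊ p? ⌋ ∧ ⌊ q? ⌋ ∧ ⌊ s? ⌋) ≡ 0
𝟙-⌊⌋³-false (yes p) (yes q) (yes s) ¬pqs = contradiction (p , q , s) ¬pqs
𝟙-⌊⌋³-false (yes _) (yes _) (no _)  _    = refl
𝟙-⌊⌋³-false (yes _) (no _)  _       _    = refl
𝟙-⌊⌋³-false (no _)  _       _       _    = refl

𝟙-trichotomy : ∀ {k} (a b : Fin k) r →
               𝟙 (⌊ a Fin.<? b ⌋ ∧ r) + 𝟙 (⌊ b Fin.<? a ⌋ ∧ r) ≡ 𝟙 (r ∧ not ⌊ a Fin.≟ b ⌋)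
𝟙-trichotomy a b r with <-cmp a b
... | tri< a<b _ b≮a
  rewrite ⌊⌋-true (a Fin.<? b) a<b | ⌊⌋-false (b Fin.<? a) b≮a | ⌊⌋-false (a Fin.≟ b) (<⇒≢ a<b)
  = +-identityʳ _ ∙ cong 𝟙 (sym (∧-identityʳ r))
... | tri≈ a≮b refl _
  rewrite ⌊⌋-false (a Fin.<? a) a≮b | ⌊⌋-refl a = cong 𝟙 (sym (∧-zeroʳ r))
... | tri> a≮b _ b<a
  rewrite ⌊⌋-false (a Fin.<? b) a≮b | ⌊⌋-true (b Fin.<? a) b<a | ⌊⌋-false (a Fin.≟ b) (<⇒≢ b<a ∘ sym)
  = cong 𝟙 (sym (∧-identityʳ r))

toggle : ∀ {k} → Fin k → Vec Bool k → Vec Bool k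
toggle j c = c [ j ]%= not

toggle-involutive : ∀ {k} (j : Fin k) c → toggle j (toggle j c) ≡ c
toggle-involutive j c = updateAt-updateAt-local j c (not-involutive _) ∙ updateAt-id j c

toggle-injective : ∀ {k} {j j′ : Fin k} c → toggle j c ≡ toggle j′ c → j ≡ j′
toggle-injective {j = j} {j′} c eq with j Fin.≟ j′
... | yes j≡j′ = j≡j′
... | no j≢j′  = contradiction
  (sym (lookup∘updateAt j c) ∙ cong (λ d → Vec.lookup d j) eq ∙ lookup∘updateAt′ j j′ j≢j′ c)
  (not-¬ refl ∘ sym)

∑ : {A : Set} → List A → (A → ℕ) → ℕ
∑ xs f = sum (map f xs)

syntax ∑ xs (λ x → e) = ∑[ x ∈ xs ] e

private
  variable
    A B : Set

∑-cong : ∀ (xs : List A) {f g : A → ℕ} → (∀ x → f x ≡ g x) → ∑ xs f ≡ ∑ xs g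
∑-cong []       eq = refl
∑-cong (x ∷ xs) eq = cong₂ _+_ (eq x) (∑-cong xs eq)

∑-zero : ∀ (xs : List A) {f : A → ℕ} → (∀ {x} → x ∈ xs → f x ≡ 0) → ∑ xs f ≡ 0
∑-zero []       eq = refl
∑-zero (x ∷ xs) eq = cong₂ _+_ (eq (here refl)) (∑-zero xs (eq ∘ there))

∑-+ : ∀ (xs : List A) (f g : A → ℕ) → ∑[ x ∈ xs ] (f x + g x) ≡ ∑ xs f + ∑ xs g
∑-+ []       f g = refl
∑-+ (x ∷ xs) f g =
  trans (cong (f x + g x +_) (∑-+ xs f g)) (interchange +-commutativeSemigroup (f x) (g x) _ _)

∑-++ : ∀ (xs ys : List A) (f : A → ℕ) → ∑ (xs ++ ys) f ≡ ∑ xs f + ∑ ys f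
∑-++ xs ys f = trans (cong sum (map-++ f xs ys)) (sum-++ (map f xs) (map f ys))

∑-comm : ∀ (xs : List A) (ys : List B) (f : A → B → ℕ) →
         ∑[ x ∈ xs ] ∑[ y ∈ ys ] f x y ≡ ∑[ y ∈ ys ] ∑[ x ∈ xs ] f x y
∑-comm []       ys f = sym (∑-zero ys (λ _ → refl))
∑-comm (x ∷ xs) ys f =
  trans (cong (∑ ys (f x) +_) (∑-comm xs ys f)) (sym (∑-+ ys (f x) (λ y → ∑[ x ∈ xs ] f x y)))

∑-concatMap : ∀ (xs : List A) (g : A → List B) (f : B → ℕ) →
              ∑ (concatMap g xs) f ≡ ∑[ x ∈ xs ] ∑ (g x) f
∑-concatMap []       g f = refl
∑-concatMap (x ∷ xs) g f =
  trans (∑-++ (g x) (concatMap g xs) f) (cong (∑ (g x) f +_) (∑-concatMap xs g f))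

∑-lookup : ∀ (xs : List A) (f : A → ℕ) → ∑[ i ∈ allFin (length xs) ] f (lookup xs i) ≡ ∑ xs f
∑-lookup xs f = cong sum (begin
  map (f ∘ lookup xs) (allFin (length xs))       ≡⟨ map-∘ (allFin (length xs)) ⟩
  map f (map (lookup xs) (allFin (length xs)))   ≡⟨ cong (map f) (map-tabulate (λ i → i) (lookup xs)) ⟩
  map f (Data.List.tabulate (lookup xs))          ≡⟨ cong (map f) (tabulate-lookup xs) ⟩
  map f xs                                        ∎)
  where open ≡-Reasoning

∑-point : ∀ {xs : List A} {x} {f : A → ℕ} → Unique xs → x ∈ xs →
          (∀ y → y ≢ x → f y ≡ 0) → ∑ xs f ≡ f x
∑-point {xs = x ∷ xs} (x∉xs ∷ _) (here refl) off =
  trans (cong (_ +_) (∑-zero xs (λ y∈xs → off _ (≢-sym (All.lookup x∉xs y∈xs))))) (+-identityʳ _)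
∑-point {xs = y ∷ xs} (y∉xs ∷ uxs) (there x∈xs) off =
  cong₂ _+_ (off y (All.lookup y∉xs x∈xs)) (∑-point uxs x∈xs off)

record Enumeration {A : Set} (xs : List A) : Set where
  field
    unique   : Unique xs
    complete : ∀ x → x ∈ xs

∑-enumeration-point : ∀ {xs : List A} {f : A → ℕ} → Enumeration xs → ∀ x →
                      (∀ y → y ≢ x → f y ≡ 0) → ∑ xs f ≡ f x
∑-enumeration-point enum x = ∑-point (Enumeration.unique enum) (Enumeration.complete enum x)

allFin-enumeration : ∀ n → Enumeration (allFin n)
allFin-enumeration n = record { unique = Unique.allFin⁺ n ; complete = ∈-allFin }

cartesianProduct-enumeration : ∀ {xs : List A} {ys : List B} →
  Enumeration xs → Enumeration ys → Enumeration (cartesianProduct xs ys)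
cartesianProduct-enumeration exs eys = record
  { unique   = Unique.cartesianProduct⁺ (Enumeration.unique exs) (Enumeration.unique eys)
  ; complete = λ (x , y) → ∈-cartesianProduct⁺ (Enumeration.complete exs x) (Enumeration.complete eys y)
  }

allVecs-enumeration : ∀ k → Enumeration (allVecs k)
allVecs-enumeration zero    = record { unique = [] ∷ [] ; complete = λ { [] → here refl } }
allVecs-enumeration (suc k) = record
  { unique   = Unique.++⁺ (Unique.map⁺ ∷-injectiveʳ unique) (Unique.map⁺ ∷-injectiveʳ unique) heads-differ
  ; complete = λ { (true ∷ v)  → ∈-++⁺ˡ (∈-map⁺ (true ∷_) (complete v))
                 ; (false ∷ v) → ∈-++⁺ʳ _ (∈-map⁺ (false ∷_) (complete v)) }
  }
  where
  open Enumeration (allVecs-enumeration k)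
  heads-differ : Disjoint (map (true ∷_) (allVecs k)) (map (false ∷_) (allVecs k))
  heads-differ (t∈ , f∈) with ∈-map⁻ (true ∷_) t∈ | ∈-map⁻ (false ∷_) f∈
  ... | _ , _ , refl | _ , _ , ()

∑-𝟙-select : ∀ {xs : List A} (_≟_ : DecidableEquality A) → Enumeration xs →
             ∀ x (g : A → Bool) → ∑[ y ∈ xs ] 𝟙 (⌊ y ≟ x ⌋ ∧ g y) ≡ 𝟙 (g x)
∑-𝟙-select _≟_ enum x g =
  ∑-enumeration-point enum x (λ y y≢x → cong (λ b → 𝟙 (b ∧ g y)) (⌊⌋-false (y ≟ x) y≢x))
  ∙ cong (λ b → 𝟙 (b ∧ g x)) (⌊⌋-true (x ≟ x) refl)

record Indexing {A : Set} (xs : List A) : Set where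
  field
    size      : ℕ
    element   : Fin (suc size) → A
    ∑-element : ∀ f → ∑[ i ∈ allFin (suc size) ] f (element i) ≡ ∑ xs f

indexing : ∀ {xs : List A} {x} → x ∈ xs → Indexing xs
indexing {xs = y ∷ ys} _ =
  record { size = length ys ; element = lookup (y ∷ ys) ; ∑-element = ∑-lookup (y ∷ ys) }

record _≈ᵉ_ {n m V : ℕ} (e₁ e₂ : AtomEnv n m V) : Set where
  field
    unary≗  : ∀ i v → AtomEnv.unary e₁ i v ≡ AtomEnv.unary e₂ i v
    binary≗ : ∀ i v w → AtomEnv.binary e₁ i v w ≡ AtomEnv.binary e₂ i v w
    equal≗  : ∀ v w → AtomEnv.equal e₁ v w ≡ AtomEnv.equal e₂ v w

⟦⟧-cong : ∀ {n m V} (ψ : QF n m V) {e₁ e₂ : AtomEnv n m V} → e₁ ≈ᵉ e₂ → ⟦ ψ ⟧ e₁ ≡ ⟦ ψ ⟧ e₂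
⟦⟧-cong ⊤'        e≈ = refl
⟦⟧-cong ⊥'        e≈ = refl
⟦⟧-cong (U i v)   e≈ = _≈ᵉ_.unary≗ e≈ i v
⟦⟧-cong (R i v w) e≈ = _≈ᵉ_.binary≗ e≈ i v w
⟦⟧-cong (v ≐ w)   e≈ = _≈ᵉ_.equal≗ e≈ v w
⟦⟧-cong (¬' ψ)    e≈ = cong not (⟦⟧-cong ψ e≈)
⟦⟧-cong (ψ ∧' χ)  e≈ = cong₂ _∧_ (⟦⟧-cong ψ e≈) (⟦⟧-cong χ e≈)
⟦⟧-cong (ψ ∨' χ)  e≈ = cong₂ _∨_ (⟦⟧-cong ψ e≈) (⟦⟧-cong χ e≈)
⟦⟧-cong (ψ ⇒' χ)  e≈ = cong₂ (λ p q → not p ∨ q) (⟦⟧-cong ψ e≈) (⟦⟧-cong χ e≈)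

module _ {n m : ℕ} (𝔄 : FinStructure n m) where
  open FinStructure 𝔄

  type₁ : Dom 𝔄 → OneTp n m
  type₁ a = Vec.tabulate (λ i → Uᴵ i a) , Vec.tabulate (λ t → Rᴵ t a a)

  type₂ : Dom 𝔄 → Dom 𝔄 → TwoTp m
  type₂ a b = Vec.tabulate (λ t → Rᴵ t a b) , Vec.tabulate (λ t → Rᴵ t b a)

  assign1≈type₁ : ∀ a → envᴬ 𝔄 (assign1 𝔄 a) ≈ᵉ env₁ (type₁ a)
  assign1≈type₁ a = record
    { unary≗  = λ i _ → sym (lookup∘tabulate _ i)
    ; binary≗ = λ t _ _ → sym (lookup∘tabulate _ t)
    ; equal≗  = λ _ _ → ⌊⌋-refl a
    }

  assign2≈type₂ : ∀ {a b} → a ≢ b → envᴬ 𝔄 (assign2 𝔄 a b) ≈ᵉ env₂ (type₁ a) (type₂ a b) (type₁ b)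
  assign2≈type₂ {a} {b} a≢b = record { unary≗ = unary≗ ; binary≗ = binary≗ ; equal≗ = equal≗ }
    where
    unary≗ : ∀ i (v : Fin 2) → _
    unary≗ i zero       = sym (lookup∘tabulate _ i)
    unary≗ i (suc zero) = sym (lookup∘tabulate _ i)
    binary≗ : ∀ t (v w : Fin 2) → _
    binary≗ t zero       zero       = sym (lookup∘tabulate _ t)
    binary≗ t zero       (suc zero) = sym (lookup∘tabulate _ t)
    binary≗ t (suc zero) zero       = sym (lookup∘tabulate _ t)
    binary≗ t (suc zero) (suc zero) = sym (lookup∘tabulate _ t)
    equal≗ : ∀ (v w : Fin 2) → _
    equal≗ zero       zero       = ⌊⌋-refl a
    equal≗ zero       (suc zero) = ⌊⌋-false (a Fin.≟ b) a≢b
    equal≗ (suc zero) zero       = ⌊⌋-false (b Fin.≟ a) (a≢b ∘ sym)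
    equal≗ (suc zero) (suc zero) = ⌊⌋-refl b

CountingConstraint : ∀ {n m} → NormalForm n m → Fin n → (Fin m → ℕ) → Set
CountingConstraint {m = m} φ i deg =
  ⟦ cmp i ⟧ᶜ (sumℤ (map (λ t → λ' i t ℤ.* ℤ.+ deg t) (allFin m))) (δ i)
  where open NormalForm φ

CountingConstraint-cong : ∀ {n m} (φ : NormalForm n m) i {deg deg′ : Fin m → ℕ} →
  (∀ t → deg t ≡ deg′ t) → CountingConstraint φ i deg → CountingConstraint φ i deg′
CountingConstraint-cong {m = m} φ i eq = subst (λ s → ⟦ cmp i ⟧ᶜ s (δ i))
  (cong sumℤ (map-cong (λ t → cong (λ d → λ' i t ℤ.* ℤ.+ d) (eq t)) (allFin m)))
  where open NormalForm φ

module _ {n m : ℕ} (φ : NormalForm n m) (𝔄 : FinStructure n m) where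
  open NormalForm φ
  open FinStructure 𝔄

  entails₂-type₂⇔ : ∀ {a b} → a ≢ b →
    Entails₂ φ (type₁ 𝔄 a) (type₂ 𝔄 a b) (type₁ 𝔄 b) ⇔
    (∀ i → Rᴵ i a b ≡ true → ⟦ α i ⟧ (envᴬ 𝔄 (assign2 𝔄 a b)) ≡ true)
  entails₂-type₂⇔ {a} {b} a≢b = mk⇔
    (λ ent i → Equivalence.to (clause⇔ i) (ent i))
    (λ sat i → Equivalence.from (clause⇔ i) (sat i))
    where
    clause⇔ : ∀ i → (⟦ (R i zero (suc zero) ∧' ¬' (zero ≐ suc zero)) ⇒' α i ⟧
                        (env₂ (type₁ 𝔄 a) (type₂ 𝔄 a b) (type₁ 𝔄 b)) ≡ true) ⇔
                     (Rᴵ i a b ≡ true → ⟦ α i ⟧ (envᴬ 𝔄 (assign2 𝔄 a b)) ≡ true)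
    clause⇔ i
      rewrite sym (⟦⟧-cong ((R i zero (suc zero) ∧' ¬' (zero ≐ suc zero)) ⇒' α i) (assign2≈type₂ 𝔄 a≢b))
            | ⌊⌋-false (a Fin.≟ b) a≢b | ∧-identityʳ (Rᴵ i a b)
      = implication-true (Rᴵ i a b) _

  ⊨⇔compatible-types :
    𝔄 ⊨ φ ⇔ ((∀ a → Compatible₁ φ (type₁ 𝔄 a))
            × (∀ a b → a ≢ b → Entails₂ φ (type₁ 𝔄 a) (type₂ 𝔄 a b) (type₁ 𝔄 b))
            × (∀ i a → Uᴵ i a ≡ true → CountingConstraint φ i (λ t → outCount 𝔄 t a)))
  ⊨⇔compatible-types = mk⇔
    (λ (sat-γ , sat-α , sat-counts) →
         (λ a → trans (sym (⟦⟧-cong γ (assign1≈type₁ 𝔄 a))) (sat-γ a))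
       , (λ a b a≢b → Equivalence.from (entails₂-type₂⇔ a≢b) (λ i r → sat-α i a b r a≢b))
       , sat-counts)
    (λ (comp₁ , ent₂ , counts) →
         (λ a → trans (⟦⟧-cong γ (assign1≈type₁ 𝔄 a)) (comp₁ a))
       , (λ i a b r a≢b → Equivalence.to (entails₂-type₂⇔ a≢b) (ent₂ a b a≢b) i r)
       , counts)

module Realise {n m k : ℕ} {A : Set} (element : Fin (suc k) → A)
               (τ₁ : A → OneTp n m) (τ₂ : A → A → TwoTp m) where

  realise : FinStructure n m
  realise = record
    { size = k
    ; Uᴵ   = λ i a → Vec.lookup (proj₁ (τ₁ (element a))) i
    ; Rᴵ   = λ t a b → if ⌊ a Fin.≟ b ⌋ then Vec.lookup (proj₂ (τ₁ (element a))) t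
                                         else InTwoTps t (τ₂ (element a) (element b))
    }
  open FinStructure realise

  Rᴵ-diagonal : ∀ t a → Rᴵ t a a ≡ Vec.lookup (proj₂ (τ₁ (element a))) t
  Rᴵ-diagonal t a rewrite ⌊⌋-refl a = refl

  Rᴵ-off-diagonal : ∀ t {a b} → a ≢ b → Rᴵ t a b ≡ InTwoTps t (τ₂ (element a) (element b))
  Rᴵ-off-diagonal t {a} {b} a≢b rewrite ⌊⌋-false (a Fin.≟ b) a≢b = refl

  type₁-realise : ∀ a → type₁ realise a ≡ τ₁ (element a)
  type₁-realise a = cong₂ _,_ (tabulate∘lookup _)
                              (trans (tabulate-cong (λ t → Rᴵ-diagonal t a)) (tabulate∘lookup _))

  type₂-realise : (∀ x y → τ₂ y x ≡ dual (τ₂ x y)) →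
                  ∀ {a b} → a ≢ b → type₂ realise a b ≡ τ₂ (element a) (element b)
  type₂-realise τ₂-dual {a} {b} a≢b = cong₂ _,_
    (trans (tabulate-cong (λ t → Rᴵ-off-diagonal t a≢b)) (tabulate∘lookup _))
    (trans (tabulate-cong (λ t → Rᴵ-off-diagonal t (a≢b ∘ sym)))
           (trans (tabulate∘lookup _) (cong proj₁ (τ₂-dual (element a) (element b)))))

  outCount-realise : (∀ x t → InTwoTps t (τ₂ x x) ≡ false) → ∀ t a →
    outCount realise t a ≡ ∑[ b ∈ allFin (suc k) ] 𝟙 (InTwoTps t (τ₂ (element a) (element b)))
  outCount-realise τ₂-irreflexive t a = ∑-cong (allFin (suc k)) arc
    where
    arc : ∀ b → 𝟙 (Rᴵ t a b ∧ not ⌊ a Fin.≟ b ⌋) ≡ 𝟙 (InTwoTps t (τ₂ (element a) (element b)))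
    arc b with a Fin.≟ b
    ... | yes refl = cong 𝟙 (trans (∧-zeroʳ _) (sym (τ₂-irreflexive (element a) t)))
    ... | no _     = cong 𝟙 (∧-identityʳ _)

allOneTps-enumeration : ∀ n m → Enumeration (allOneTps n m)
allOneTps-enumeration n m = cartesianProduct-enumeration (allVecs-enumeration n) (allVecs-enumeration m)

allTwoTps-enumeration : ∀ m → Enumeration (allTwoTps m)
allTwoTps-enumeration m = cartesianProduct-enumeration (allVecs-enumeration m) (allVecs-enumeration m)

module _ {n m : ℕ} where

  outDegree : Fin m → (TwoTp m → OneTp n m → ℕ) → ℕ
  outDegree t x = ∑[ η ∈ allTwoTps m ] (if InTwoTps t η then ∑[ π ∈ allOneTps n m ] x η π else 0)

  outDegree-cong : ∀ t {x y : TwoTp m → OneTp n m → ℕ} →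
                   (∀ η π → x η π ≡ y η π) → outDegree t x ≡ outDegree t y
  outDegree-cong t x≗y = ∑-cong (allTwoTps m) λ η →
    cong (if InTwoTps t η then_else 0) (∑-cong (allOneTps n m) (x≗y η))

  outDegree-+ : ∀ t (x y : TwoTp m → OneTp n m → ℕ) →
                outDegree t (λ η π → x η π + y η π) ≡ outDegree t x + outDegree t y
  outDegree-+ t x y = trans (∑-cong (allTwoTps m) split) (∑-+ (allTwoTps m) _ _)
    where
    split : ∀ η → (if InTwoTps t η then ∑[ π ∈ allOneTps n m ] (x η π + y η π) else 0)
                ≡ (if InTwoTps t η then ∑ (allOneTps n m) (x η) else 0)
                  + (if InTwoTps t η then ∑ (allOneTps n m) (y η) else 0)
    split η with InTwoTps t η
    ... | true  = ∑-+ (allOneTps n m) (x η) (y η)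
    ... | false = refl

  outDegree-∑ : ∀ {E : Set} t (es : List E) (x : E → TwoTp m → OneTp n m → ℕ) →
                outDegree t (λ η π → ∑[ e ∈ es ] x e η π) ≡ ∑[ e ∈ es ] outDegree t (x e)
  outDegree-∑ t []       x = ∑-zero (allTwoTps m) λ {η} _ →
    cong (if InTwoTps t η then_else 0) (∑-zero (allOneTps n m) (λ _ → refl)) ∙ if-same (InTwoTps t η)
    where
    if-same : ∀ b → (if b then 0 else 0) ≡ 0
    if-same true  = refl
    if-same false = refl
  outDegree-∑ t (e ∷ es) x =
    trans (outDegree-+ t (x e) (λ η π → ∑[ e ∈ es ] x e η π))
          (cong (outDegree t (x e) +_) (outDegree-∑ t es x))

  outDegree-point : ∀ t s η₀ π₀ →
    outDegree t (λ η π → 𝟙 (s ∧ ⌊ η₀ ≟₂ η ⌋ ∧ ⌊ π₀ ≟₁ π ⌋)) ≡ 𝟙 (s ∧ InTwoTps t η₀)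
  outDegree-point t s η₀ π₀ = begin
    outDegree t (λ η π → 𝟙 (s ∧ ⌊ η₀ ≟₂ η ⌋ ∧ ⌊ π₀ ≟₁ π ⌋))
      ≡⟨ ∑-cong (allTwoTps m) (λ η → cong (if InTwoTps t η then_else 0) (sum-over-π η)) ⟩
    ∑[ η ∈ allTwoTps m ] (if InTwoTps t η then 𝟙 (s ∧ ⌊ η₀ ≟₂ η ⌋) else 0)
      ≡⟨ ∑-enumeration-point (allTwoTps-enumeration m) η₀ off-η₀ ⟩
    (if InTwoTps t η₀ then 𝟙 (s ∧ ⌊ η₀ ≟₂ η₀ ⌋) else 0)
      ≡⟨ at-η₀ (InTwoTps t η₀) s (⌊⌋-true (η₀ ≟₂ η₀) refl) ⟩
    𝟙 (s ∧ InTwoTps t η₀)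
      ∎
    where
    open ≡-Reasoning
    ∧-zeroʳ-under : ∀ a b → a ∧ b ∧ false ≡ false
    ∧-zeroʳ-under a b = trans (cong (a ∧_) (∧-zeroʳ b)) (∧-zeroʳ a)
    sum-over-π : ∀ η → ∑[ π ∈ allOneTps n m ] 𝟙 (s ∧ ⌊ η₀ ≟₂ η ⌋ ∧ ⌊ π₀ ≟₁ π ⌋) ≡ 𝟙 (s ∧ ⌊ η₀ ≟₂ η ⌋)
    sum-over-π η =
      trans (∑-enumeration-point (allOneTps-enumeration n m) π₀
               (λ π π≢π₀ → cong (λ c → 𝟙 (s ∧ ⌊ η₀ ≟₂ η ⌋ ∧ c)) (⌊⌋-false (π₀ ≟₁ π) (π≢π₀ ∘ sym))
                           ∙ cong 𝟙 (∧-zeroʳ-under s _)))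
            (cong (λ c → 𝟙 (s ∧ ⌊ η₀ ≟₂ η ⌋ ∧ c)) (⌊⌋-true (π₀ ≟₁ π₀) refl)
             ∙ cong (λ b → 𝟙 (s ∧ b)) (∧-identityʳ _))
    off-η₀ : ∀ η → η ≢ η₀ → (if InTwoTps t η then 𝟙 (s ∧ ⌊ η₀ ≟₂ η ⌋) else 0) ≡ 0
    off-η₀ η η≢η₀ rewrite ⌊⌋-false (η₀ ≟₂ η) (η≢η₀ ∘ sym) | ∧-zeroʳ s with InTwoTps t η
    ... | true  = refl
    ... | false = refl
    at-η₀ : ∀ r s {e} → e ≡ true → (if r then 𝟙 (s ∧ e) else 0) ≡ 𝟙 (s ∧ r)
    at-η₀ true  s refl = refl
    at-η₀ false s refl = cong 𝟙 (sym (∧-zeroʳ s))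

silent : ∀ {m} → TwoTp m
silent {m} = Vec.replicate m false , Vec.replicate m false

silent-compatible : ∀ {n m} (φ : NormalForm n m) π π′ → Compatible₂ φ π silent π′
silent-compatible φ π π′ = no-arc π π′ , no-arc π′ π
  where
  no-arc : ∀ π π′ → Entails₂ φ π silent π′
  no-arc π π′ i rewrite lookup-replicate i false = refl

arcs : ∀ {k m} → Fin m → Fin k → Edge k m → ℕ
arcs t v e = 𝟙 (⌊ Edge.src e Fin.≟ v ⌋ ∧ InTwoTps t (Edge.tp e))
           + 𝟙 (⌊ Edge.tgt e Fin.≟ v ⌋ ∧ InTwoTps t (dual (Edge.tp e)))

module _ {n m : ℕ} (G : ColoredMultigraph n m) where
  open ColoredMultigraph G
  open Edge

  incidences : Fin (suc size) → Edge (suc size) m → TwoTp m → OneTp n m → ℕ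
  incidences v e η π = 𝟙 (⌊ src e Fin.≟ v ⌋ ∧ ⌊ tp e ≟₂ η ⌋ ∧ ⌊ oneTp (tgt e) ≟₁ π ⌋)
                     + 𝟙 (⌊ tgt e Fin.≟ v ⌋ ∧ ⌊ dual (tp e) ≟₂ η ⌋ ∧ ⌊ oneTp (src e) ≟₁ π ⌋)

  bh≡∑incidences : ∀ v η π → bh G v η π ≡ ∑[ e ∈ edges ] incidences v e η π
  bh≡∑incidences v η π = go edges
    where
    -- bh sums an indicator private to Defs, which computes only on true and false.
    go : ∀ es → bh (record G { edges = es }) v η π ≡ ∑[ e ∈ es ] incidences v e η π
    go []       = refl
    go (e ∷ es) with ⌊ src e Fin.≟ v ⌋ ∧ ⌊ tp e ≟₂ η ⌋ ∧ ⌊ oneTp (tgt e) ≟₁ π ⌋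
                   | ⌊ tgt e Fin.≟ v ⌋ ∧ ⌊ dual (tp e) ≟₂ η ⌋ ∧ ⌊ oneTp (src e) ≟₁ π ⌋
    ... | true  | true  = cong (2 +_) (go es)
    ... | true  | false = cong (1 +_) (go es)
    ... | false | true  = cong (1 +_) (go es)
    ... | false | false = go es

  outDegree-bh : ∀ t v → outDegree t (bh G v) ≡ ∑[ e ∈ edges ] arcs t v e
  outDegree-bh t v = begin
    outDegree t (bh G v)                                      ≡⟨ outDegree-cong t (bh≡∑incidences v) ⟩
    outDegree t (λ η π → ∑[ e ∈ edges ] incidences v e η π)  ≡⟨ outDegree-∑ t edges (incidences v) ⟩
    ∑[ e ∈ edges ] outDegree t (incidences v e)               ≡⟨ ∑-cong edges outDegree-incidences ⟩
    ∑[ e ∈ edges ] arcs t v e                                 ∎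
    where
    open ≡-Reasoning
    outDegree-incidences : ∀ e → outDegree t (incidences v e) ≡ arcs t v e
    outDegree-incidences e = outDegree-+ {n = n} t _ _
      ∙ cong₂ _+_ (outDegree-point t ⌊ src e Fin.≟ v ⌋ (tp e) (oneTp (tgt e)))
                  (outDegree-point t ⌊ tgt e Fin.≟ v ⌋ (dual (tp e)) (oneTp (src e)))

  bh-vanishes : ∀ {v η π} →
    (∀ {e} → e ∈ edges → ¬ (src e ≡ v × tp e ≡ η × oneTp (tgt e) ≡ π)
                       × ¬ (tgt e ≡ v × dual (tp e) ≡ η × oneTp (src e) ≡ π)) →
    bh G v η π ≡ 0
  bh-vanishes {v} {η} {π} unrealised = bh≡∑incidences v η π ∙ ∑-zero edges (λ {e} e∈ →
    cong₂ _+_ (𝟙-⌊⌋³-false (src e Fin.≟ v) (tp e ≟₂ η) (oneTp (tgt e) ≟₁ π) (proj₁ (unrealised e∈)))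
              (𝟙-⌊⌋³-false (tgt e Fin.≟ v) (dual (tp e) ≟₂ η) (oneTp (src e) ≟₁ π)
                            (proj₂ (unrealised e∈))))

  module _ (φ : NormalForm n m)
           (vertices-compatible : ∀ v → Compatible₁ φ (oneTp v))
           (edges-compatible : ∀ e → e ∈ edges → Compatible₂ φ (oneTp (src e)) (tp e) (oneTp (tgt e))) where

    bh-incompatible₁ : ∀ v η π → ¬ Compatible₁ φ π → bh G v η π ≡ 0
    bh-incompatible₁ v η π ¬c = bh-vanishes λ _ →
      (λ { (_ , _ , refl) → ¬c (vertices-compatible _) }) ,
      (λ { (_ , _ , refl) → ¬c (vertices-compatible _) })

    bh-incompatible₂ : ∀ v η π → ¬ Compatible₂ φ (oneTp v) η π → bh G v η π ≡ 0
    bh-incompatible₂ v η π ¬c = bh-vanishes λ e∈ →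
      (λ { (refl , refl , refl) → ¬c (edges-compatible _ e∈) }) ,
      (λ { (refl , refl , refl) → ¬c (swap (edges-compatible _ e∈)) })

    isPseudoModel : (∀ v i → Vec.lookup (proj₁ (oneTp v)) i ≡ true →
                       CountingConstraint φ i (λ t → ∑[ e ∈ edges ] arcs t v e)) →
                    IsPseudoModel φ G
    isPseudoModel counts = vertices-compatible , edges-compatible , λ v →
        (λ η π _ → bh-incompatible₁ v η π)
      , (λ η π _ → bh-incompatible₂ v η π)
      , (λ i u → CountingConstraint-cong φ i (λ t → sym (outDegree-bh t v)) (counts v i u))

-- From a model to a pseudo-model

module TypeGraph {n m : ℕ} (𝔄 : FinStructure n m) where
  open FinStructure 𝔄

  edgeIfBelow : Dom 𝔄 → Dom 𝔄 → List (Edge (suc size) m)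
  edgeIfBelow a b with a Fin.<? b
  ... | yes a<b = record { src = a ; tgt = b ; distinct = <⇒≢ a<b ; tp = type₂ 𝔄 a b } ∷ []
  ... | no _    = []

  edgesFrom : Dom 𝔄 → List (Edge (suc size) m)
  edgesFrom a = concatMap (edgeIfBelow a) (allFin (suc size))

  pairEdges : List (Edge (suc size) m)
  pairEdges = concatMap edgesFrom (allFin (suc size))

  typeGraph : ColoredMultigraph n m
  typeGraph = record { size = size ; oneTp = type₁ 𝔄 ; edges = pairEdges }

  pairEdges-tp : ∀ {e} → e ∈ pairEdges → Edge.tp e ≡ type₂ 𝔄 (Edge.src e) (Edge.tgt e)
  pairEdges-tp e∈ with satisfied (∈-concatMap⁻ edgesFrom {xs = allFin (suc size)} e∈)
  ... | a , e∈a with satisfied (∈-concatMap⁻ (edgeIfBelow a) {xs = allFin (suc size)} e∈a)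
  ... | b , e∈ab with a Fin.<? b | e∈ab
  ...   | yes _ | here refl = refl

  arcs-edgeIfBelow : ∀ t v a b →
    ∑ (edgeIfBelow a b) (arcs t v) ≡ 𝟙 (⌊ a Fin.≟ v ⌋ ∧ ⌊ a Fin.<? b ⌋ ∧ Rᴵ t a b)
                                    + 𝟙 (⌊ b Fin.≟ v ⌋ ∧ ⌊ a Fin.<? b ⌋ ∧ Rᴵ t b a)
  arcs-edgeIfBelow t v a b with a Fin.<? b
  ... | yes _ rewrite lookup∘tabulate (λ t → Rᴵ t a b) t | lookup∘tabulate (λ t → Rᴵ t b a) t
    = +-identityʳ _
  ... | no _  = sym (cong₂ _+_ (cong 𝟙 (∧-zeroʳ ⌊ a Fin.≟ v ⌋)) (cong 𝟙 (∧-zeroʳ ⌊ b Fin.≟ v ⌋)))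

  ∑-arcs-pairEdges : ∀ t v → ∑[ e ∈ pairEdges ] arcs t v e ≡ outCount 𝔄 t v
  ∑-arcs-pairEdges t v = begin
    ∑[ e ∈ pairEdges ] arcs t v e
      ≡⟨ ∑-concatMap Dᴬ edgesFrom (arcs t v) ∙ ∑-cong Dᴬ (λ a → ∑-concatMap Dᴬ (edgeIfBelow a) (arcs t v)) ⟩
    ∑[ a ∈ Dᴬ ] ∑[ b ∈ Dᴬ ] ∑ (edgeIfBelow a b) (arcs t v)
      ≡⟨ ∑-cong Dᴬ (λ a → ∑-cong Dᴬ (arcs-edgeIfBelow t v a) ∙ ∑-+ Dᴬ (X a) (Y a))
         ∙ ∑-+ Dᴬ (∑ Dᴬ ∘ X) (∑ Dᴬ ∘ Y) ⟩
    ∑[ a ∈ Dᴬ ] ∑[ b ∈ Dᴬ ] 𝟙 (⌊ a Fin.≟ v ⌋ ∧ ⌊ a Fin.<? b ⌋ ∧ Rᴵ t a b)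
      + ∑[ a ∈ Dᴬ ] ∑[ b ∈ Dᴬ ] 𝟙 (⌊ b Fin.≟ v ⌋ ∧ ⌊ a Fin.<? b ⌋ ∧ Rᴵ t b a)
      ≡⟨ cong₂ _+_ (∑-comm Dᴬ Dᴬ X ∙ ∑-cong Dᴬ (λ b → select (λ a → ⌊ a Fin.<? b ⌋ ∧ Rᴵ t a b)))
                   (∑-cong Dᴬ (λ a → select (λ b → ⌊ a Fin.<? b ⌋ ∧ Rᴵ t b a))) ⟩
    ∑[ b ∈ Dᴬ ] 𝟙 (⌊ v Fin.<? b ⌋ ∧ Rᴵ t v b) + ∑[ b ∈ Dᴬ ] 𝟙 (⌊ b Fin.<? v ⌋ ∧ Rᴵ t v b)
      ≡⟨ sym (∑-+ Dᴬ (λ b → 𝟙 (⌊ v Fin.<? b ⌋ ∧ Rᴵ t v b)) (λ b → 𝟙 (⌊ b Fin.<? v ⌋ ∧ Rᴵ t v b)))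
         ∙ ∑-cong Dᴬ (λ b → 𝟙-trichotomy v b (Rᴵ t v b)) ⟩
    outCount 𝔄 t v
      ∎
    where
    open ≡-Reasoning
    Dᴬ = allFin (suc size)
    X Y : Dom 𝔄 → Dom 𝔄 → ℕ
    X a b = 𝟙 (⌊ a Fin.≟ v ⌋ ∧ ⌊ a Fin.<? b ⌋ ∧ Rᴵ t a b)
    Y a b = 𝟙 (⌊ b Fin.≟ v ⌋ ∧ ⌊ a Fin.<? b ⌋ ∧ Rᴵ t b a)
    select : ∀ g → ∑[ a ∈ Dᴬ ] 𝟙 (⌊ a Fin.≟ v ⌋ ∧ g a) ≡ 𝟙 (g v)
    select = ∑-𝟙-select Fin._≟_ (allFin-enumeration (suc size)) v

open TypeGraph using (typeGraph; pairEdges; pairEdges-tp; ∑-arcs-pairEdges)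

model⇒pseudoModel : ∀ {n m} (φ : NormalForm n m) (𝔄 : FinStructure n m) →
                    𝔄 ⊨ φ → IsPseudoModel φ (typeGraph 𝔄)
model⇒pseudoModel φ 𝔄 𝔄⊨φ = isPseudoModel (typeGraph 𝔄) φ types-compatible₁ edges-compatible counts
  where
  types-compatible = Equivalence.to (⊨⇔compatible-types φ 𝔄) 𝔄⊨φ
  types-compatible₁ = proj₁ types-compatible
  types-entail₂ = proj₁ (proj₂ types-compatible)

  edges-compatible : ∀ e → e ∈ pairEdges 𝔄 →
                     Compatible₂ φ (type₁ 𝔄 (Edge.src e)) (Edge.tp e) (type₁ 𝔄 (Edge.tgt e))
  edges-compatible e e∈ rewrite pairEdges-tp 𝔄 e∈ =
    types-entail₂ _ _ (Edge.distinct e) , types-entail₂ _ _ (Edge.distinct e ∘ sym)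

  counts : ∀ v i → Vec.lookup (proj₁ (type₁ 𝔄 v)) i ≡ true →
           CountingConstraint φ i (λ t → ∑[ e ∈ pairEdges 𝔄 ] arcs t v e)
  counts v i u = CountingConstraint-cong φ i (λ t → sym (∑-arcs-pairEdges 𝔄 t v))
                   (proj₂ (proj₂ types-compatible) i v (sym (lookup∘tabulate _ i) ∙ u))

-- From a pseudo-model to a model: the 2^L-fold cover

module Lift {n m : ℕ} (G : ColoredMultigraph n m) where
  open ColoredMultigraph G
  open Edge

  L : ℕ
  L = length edges

  edge : Fin L → Edge (suc size) m
  edge = lookup edges

  Point : Set
  Point = Fin (suc size) × Vec Bool L

  points : List Point
  points = cartesianProduct (allFin (suc size)) (allVecs L)

  points-enumeration : Enumeration points
  points-enumeration = cartesianProduct-enumeration (allFin-enumeration (suc size)) (allVecs-enumeration L)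

  Joins : Fin L → Point → Point → Set
  Joins j (u , c) (w , d) = src (edge j) ≡ u × tgt (edge j) ≡ w × toggle j c ≡ d

  joins? : ∀ j a b → Dec (Joins j a b)
  joins? j (u , c) (w , d) =
    (src (edge j) Fin.≟ u) ×-dec (tgt (edge j) Fin.≟ w) ×-dec Vec.≡-dec Bool._≟_ (toggle j c) d

  joins-one-way : ∀ {j a b} → Joins j a b → ¬ Joins j b a
  joins-one-way {j} (refl , refl , _) (src≡w , _ , _) = distinct (edge j) src≡w

  joins-toggles : ∀ {j a b} → Joins j a b ⊎ Joins j b a → proj₂ b ≡ toggle j (proj₂ a)
  joins-toggles             (inj₁ (_ , _ , refl)) = refl
  joins-toggles {j} {b = b} (inj₂ (_ , _ , refl)) = sym (toggle-involutive j (proj₂ b))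

  joins-index-unique : ∀ {j j′ a b} → Joins j a b ⊎ Joins j b a → Joins j′ a b ⊎ Joins j′ b a → j ≡ j′
  joins-index-unique {a = a} p p′ = toggle-injective (proj₂ a) (sym (joins-toggles p) ∙ joins-toggles p′)

  liftTp : List (Fin L) → Point → Point → TwoTp m
  liftTp []       a b = silent
  liftTp (j ∷ js) a b with joins? j a b | joins? j b a
  ... | yes _ | _     = tp (edge j)
  ... | no _  | yes _ = dual (tp (edge j))
  ... | no _  | no _  = liftTp js a b

  liftTp-dual : ∀ js a b → liftTp js b a ≡ dual (liftTp js a b)
  liftTp-dual []       a b = refl
  liftTp-dual (j ∷ js) a b with joins? j a b | joins? j b a
  ... | yes p | yes q = contradiction q (joins-one-way p)
  ... | yes _ | no _  = refl
  ... | no _  | yes _ = refl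
  ... | no _  | no _  = liftTp-dual js a b

  liftTp-irreflexive : ∀ js a t → InTwoTps t (liftTp js a a) ≡ false
  liftTp-irreflexive []       a t = lookup-replicate t false
  liftTp-irreflexive (j ∷ js) a t with joins? j a a
  ... | yes p = contradiction p (λ q → joins-one-way q q)
  ... | no _  = liftTp-irreflexive js a t

  liftTp-compatible : ∀ (φ : NormalForm n m) →
    (∀ e → e ∈ edges → Compatible₂ φ (oneTp (src e)) (tp e) (oneTp (tgt e))) →
    ∀ js a b → Compatible₂ φ (oneTp (proj₁ a)) (liftTp js a b) (oneTp (proj₁ b))
  liftTp-compatible φ edges-compatible []       a b = silent-compatible φ _ _
  liftTp-compatible φ edges-compatible (j ∷ js) a b with joins? j a b | joins? j b a
  ... | yes (refl , refl , _) | _                     = edges-compatible (edge j) (∈-lookup j)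
  ... | no _                  | yes (refl , refl , _) = swap (edges-compatible (edge j) (∈-lookup j))
  ... | no _                  | no _                  = liftTp-compatible φ edges-compatible js a b

  arcsVia : Fin m → Fin L → Point → Point → ℕ
  arcsVia t j a b = 𝟙 (⌊ joins? j a b ⌋ ∧ InTwoTps t (tp (edge j)))
               + 𝟙 (⌊ joins? j b a ⌋ ∧ InTwoTps t (dual (tp (edge j))))

  arcsVia-other : ∀ t {j k a b} → Joins j a b ⊎ Joins j b a → k ≢ j → arcsVia t k a b ≡ 0
  arcsVia-other t {j} {k} {a} {b} joined k≢j
    rewrite ⌊⌋-false (joins? k a b) (λ q → k≢j (joins-index-unique (inj₁ q) joined))
          | ⌊⌋-false (joins? k b a) (λ q → k≢j (joins-index-unique (inj₂ q) joined)) = refl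

  ∑-arcsVia-others : ∀ t {j js a b} → Joins j a b ⊎ Joins j b a → All (j ≢_) js →
                     ∑[ k ∈ js ] arcsVia t k a b ≡ 0
  ∑-arcsVia-others t {js = js} joined j∉js =
    ∑-zero js (λ k∈js → arcsVia-other t joined (≢-sym (All.lookup j∉js k∈js)))

  𝟙-liftTp : ∀ t {js} → Unique js → ∀ a b → 𝟙 (InTwoTps t (liftTp js a b)) ≡ ∑[ j ∈ js ] arcsVia t j a b
  𝟙-liftTp t [] a b = cong 𝟙 (lookup-replicate t false)
  𝟙-liftTp t {j ∷ js} (j∉js ∷ unique) a b with joins? j a b | joins? j b a
  ... | yes p | yes q = contradiction q (joins-one-way p)
  ... | yes p | no _  = sym (cong₂ _+_ (+-identityʳ _) (∑-arcsVia-others t (inj₁ p) j∉js) ∙ +-identityʳ _)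
  ... | no _  | yes q = sym (cong (_ +_) (∑-arcsVia-others t (inj₂ q) j∉js) ∙ +-identityʳ _)
  ... | no _  | no _  = 𝟙-liftTp t unique a b

  ∑-arcsVia : ∀ t j a → ∑[ b ∈ points ] arcsVia t j a b ≡ arcs t (proj₁ a) (edge j)
  ∑-arcsVia t j (u , c) = ∑-+ points _ _ ∙ cong₂ _+_ outgoing incoming
    where
    e = edge j
    outgoing : ∑[ b ∈ points ] 𝟙 (⌊ joins? j (u , c) b ⌋ ∧ InTwoTps t (tp e))
             ≡ 𝟙 (⌊ src e Fin.≟ u ⌋ ∧ InTwoTps t (tp e))
    outgoing = ∑-enumeration-point points-enumeration (tgt e , toggle j c) off
             ∙ cong (λ s → 𝟙 (s ∧ InTwoTps t (tp e)))
                    (⌊⌋-⇔ (joins? j _ _) (src e Fin.≟ u) (mk⇔ proj₁ (λ src≡u → src≡u , refl , refl)))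
      where
      off : ∀ b → b ≢ (tgt e , toggle j c) → 𝟙 (⌊ joins? j (u , c) b ⌋ ∧ InTwoTps t (tp e)) ≡ 0
      off (w , d) b≢ rewrite ⌊⌋-false (joins? j (u , c) (w , d)) (λ { (_ , refl , refl) → b≢ refl }) = refl
    incoming : ∑[ b ∈ points ] 𝟙 (⌊ joins? j b (u , c) ⌋ ∧ InTwoTps t (dual (tp e)))
             ≡ 𝟙 (⌊ tgt e Fin.≟ u ⌋ ∧ InTwoTps t (dual (tp e)))
    incoming = ∑-enumeration-point points-enumeration (src e , toggle j c) off
             ∙ cong (λ s → 𝟙 (s ∧ InTwoTps t (dual (tp e))))
                    (⌊⌋-⇔ (joins? j _ _) (tgt e Fin.≟ u)
                          (mk⇔ (proj₁ ∘ proj₂) (λ tgt≡u → refl , tgt≡u , toggle-involutive j c)))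
      where
      off : ∀ b → b ≢ (src e , toggle j c) → 𝟙 (⌊ joins? j b (u , c) ⌋ ∧ InTwoTps t (dual (tp e))) ≡ 0
      off (w , d) b≢ rewrite ⌊⌋-false (joins? j (w , d) (u , c))
          (λ { (refl , _ , refl) → b≢ (cong (w ,_) (sym (toggle-involutive j d))) }) = refl

  ∑-liftTp : ∀ t a →
    ∑[ b ∈ points ] 𝟙 (InTwoTps t (liftTp (allFin L) a b)) ≡ ∑[ e ∈ edges ] arcs t (proj₁ a) e
  ∑-liftTp t a = begin
    ∑[ b ∈ points ] 𝟙 (InTwoTps t (liftTp (allFin L) a b))
      ≡⟨ ∑-cong points (𝟙-liftTp t (Unique.allFin⁺ L) a) ⟩
    ∑[ b ∈ points ] ∑[ j ∈ allFin L ] arcsVia t j a b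
      ≡⟨ ∑-comm points (allFin L) (λ b j → arcsVia t j a b) ⟩
    ∑[ j ∈ allFin L ] ∑[ b ∈ points ] arcsVia t j a b
      ≡⟨ ∑-cong (allFin L) (λ j → ∑-arcsVia t j a) ⟩
    ∑[ j ∈ allFin L ] arcs t (proj₁ a) (edge j)
      ≡⟨ ∑-lookup edges (arcs t (proj₁ a)) ⟩
    ∑[ e ∈ edges ] arcs t (proj₁ a) e
      ∎
    where open ≡-Reasoning

pseudoModel⇒model : ∀ {n m} (φ : NormalForm n m) (G : ColoredMultigraph n m) →
                    IsPseudoModel φ G → FinitelySatisfiable φ
pseudoModel⇒model φ G (vertices-compatible , edges-compatible , solutions) =
  realise , Equivalence.from (⊨⇔compatible-types φ realise) (types-compatible₁ , types-entail₂ , counts)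
  where
  open ColoredMultigraph G using (oneTp; edges)
  open Lift G
  open Indexing (indexing (Enumeration.complete points-enumeration (zero , Vec.replicate L false)))
  open Realise element (oneTp ∘ proj₁) (liftTp (allFin L))
  open FinStructure realise using (Uᴵ)

  types-compatible₁ : ∀ a → Compatible₁ φ (type₁ realise a)
  types-compatible₁ a rewrite type₁-realise a = vertices-compatible _

  types-entail₂ : ∀ a b → a ≢ b → Entails₂ φ (type₁ realise a) (type₂ realise a b) (type₁ realise b)
  types-entail₂ a b a≢b =
    subst₂ (λ π π′ → Entails₂ φ π (type₂ realise a b) π′) (sym (type₁-realise a)) (sym (type₁-realise b))
      (subst (λ η → Entails₂ φ (oneTp (proj₁ (element a))) η (oneTp (proj₁ (element b))))
             (sym (type₂-realise (liftTp-dual (allFin L)) a≢b))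
             (proj₁ (liftTp-compatible φ edges-compatible (allFin L) (element a) (element b))))

  counts : ∀ i a → Uᴵ i a ≡ true → CountingConstraint φ i (λ t → outCount realise t a)
  counts i a u = CountingConstraint-cong φ i degree (proj₂ (proj₂ (solutions (proj₁ (element a)))) i u)
    where
    degree : ∀ t → outDegree t (bh G (proj₁ (element a))) ≡ outCount realise t a
    degree t = begin
      outDegree t (bh G (proj₁ (element a)))
        ≡⟨ outDegree-bh G t (proj₁ (element a)) ⟩
      ∑[ e ∈ edges ] arcs t (proj₁ (element a)) e
        ≡⟨ sym (∑-liftTp t (element a)) ⟩
      ∑[ b ∈ points ] 𝟙 (InTwoTps t (liftTp (allFin L) (element a) b))
        ≡⟨ sym (∑-element (λ b → 𝟙 (InTwoTps t (liftTp (allFin L) (element a) b)))) ⟩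
      ∑[ b ∈ allFin (suc size) ] 𝟙 (InTwoTps t (liftTp (allFin L) (element a) (element b)))
        ≡⟨ sym (outCount-realise (liftTp-irreflexive (allFin L)) t a) ⟩
      outCount realise t a
        ∎
      where open ≡-Reasoning

lemma15 : ∀ (n m : ℕ) (φ : NormalForm n m) →
    FinitelySatisfiable φ ⇔ HasFinitePseudoModel φ
lemma15 n m φ = mk⇔
  (λ (𝔄 , 𝔄⊨φ) → typeGraph 𝔄 , model⇒pseudoModel φ 𝔄 𝔄⊨φ)
  (λ (G , pseudo) → pseudoModel⇒model φ G pseudo)
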